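{- Let $G=(V,E,w)$ be a weighted undirected graph with conductance $\Phi_G>0$, and let $\mathcal{T}^*$ be an optimal HC tree of $G$ whose dense branch consists only of the root of $\mathcal{T}^*$. Then every HC tree $\mathcal{T}$ of $G$ satisfies $\mathrm{cost}_G(\mathcal{T})\le \mathrm{cost}_G(\mathcal{T}^*)/\Phi_G$. In particular, $\mathrm{cost}_G(\mathcal{T}_{\deg}(G))\le \mathsf{OPT}_G/\Phi_G$.
   Context: $d_u=\sum_v w_{uv}$, $\mathrm{vol}(S)=\sum_{u\in S}d_u$, $\mathrm{vol}(G)=\mathrm{vol}(V)$, $\Phi_G=\min\{w(S,V\setminus S)/\mathrm{vol}(S): \emptyset\neq S\subset V,\ \mathrm{vol}(S)\le\mathrm{vol}(V)/2\}$ where $w(S,T)$ is the total weight of edges between $S$ and $T$. An HC tree is a rooted binary tree with leaves in bijection with $V$; nodes are identified with the vertex sets of the leaves below them. $\mathrm{cost}_G(\mathcal{T})=\sum_{e=\{u,v\}\in E} w_e\cdot|\mathsf{leaves}(\mathcal{T}[u\vee v])|$ ($u\vee v$ the lowest common ancestor); $\mathsf{OPT}_G$ is the minimum cost, attained by optimal trees. The dense branch of a tree is the path from the root obtained by repeatedly moving to the child of higher volume, consisting exactly of the nodes of volume greater than $\mathrm{vol}(G)/2$. $\mathcal{T}_{\deg}(G)$ is defined recursively: order vertices by non-increasing degree in $G$; a single vertex gives a leaf; otherwise with $r=2^{\lfloor\log_2(|V'|-1)\rfloor}$, the root has children $\mathcal{T}_{\deg}$ on the $r$ highest-degree vertices $A$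 and $\mathcal{T}_{\deg}$ on $V'\setminus A$.
   Formalization: The edge weights of G are rational, so the conductance $\Phi_G$ is rational too. -}

module Defs where

open import Data.Nat as ℕ using (ℕ; zero; suc)
open import Data.Nat.Logarithm using (⌊log₂_⌋)
open import Data.Fin using (Fin; toℕ)
open import Data.Fin.Properties using () renaming (_≟_ to _≟ᶠ_)
open import Data.Fin.Subset using (Subset; _∈_; _∉_)
open import Data.Fin.Subset.Properties using (_∈?_)
open import Data.List using (List; []; _∷_; _++_; length; map; foldr; allFin; splitAt; reverse)
open import Data.List.Relation.Binary.Permutation.Propositional using (_↭_)
open import Data.Rational using (ℚ; 0ℚ; _+_; _*_; _÷_; _≤_; _>_; _≤?_; _<?_; ½; ≢-nonZero)
open import Data.Rational.Properties using (≤-decTotalOrder) renaming (_≟_ to _≟ℚ_)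
open import Data.Product using (Σ; _×_; _,_; ∃)
open import Relation.Nullary using (yes; no; ¬_)
open import Relation.Nullary.Decidable using (⌊_⌋)
open import Relation.Binary.PropositionalEquality using (_≡_)
open import Data.Bool using (Bool; true; false; if_then_else_; _∧_)

-- Weighted undirected graphs on the vertex set Fin n, with
-- nonnegative rational weights (w u v = 0 means "no edge"),
-- symmetric, without self-loops.

record WGraph (n : ℕ) : Set where
  field
    w      : Fin n → Fin n → ℚ
    w-sym  : ∀ u v → w u v ≡ w v u
    w-nonneg : ∀ u v → 0ℚ ≤ w u v
    w-noloop : ∀ u → w u u ≡ 0ℚ
open WGraph public

Σℚ : List ℚ → ℚ
Σℚ = foldr _+_ 0ℚ

ΣV : {n : ℕ} → (Fin n → ℚ) → ℚ
ΣV {n} f = Σℚ (map f (allFin n))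

module _ {n : ℕ} (G : WGraph n) where

  deg : Fin n → ℚ
  deg u = ΣV (λ v → w G u v)

  vol : Subset n → ℚ
  vol S = ΣV (λ u → if ⌊ u ∈? S ⌋ then deg u else 0ℚ)

  volG : ℚ
  volG = ΣV deg

  cut : Subset n → ℚ
  cut S = ΣV (λ u → ΣV (λ v →
            if ⌊ u ∈? S ⌋ ∧ Data.Bool.not ⌊ v ∈? S ⌋ then w G u v else 0ℚ))

  -- w(S, V∖S) / vol(S)   (convention 0/0 := 0; vol(S) = 0 forces cut = 0)
  ratio : Subset n → ℚ
  ratio S with vol S ≟ℚ 0ℚ
  ... | yes _ = 0ℚ
  ... | no v≢0 = _÷_ (cut S) (vol S) {{≢-nonZero v≢0}}

  Admissible : Subset n → Set
  Admissible S = (∃ λ x → x ∈ S) × (∃ λ x → x ∉ S) × (vol S ≤ ½ * volG)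

  IsConductance : ℚ → Set
  IsConductance φ =
    (Σ (Subset n) λ S → Admissible S × ratio S ≡ φ) ×
    (∀ S → Admissible S → φ ≤ ratio S)

data Tree (n : ℕ) : Set where
  leaf : Fin n → Tree n
  node : Tree n → Tree n → Tree n

leaves : {n : ℕ} → Tree n → List (Fin n)
leaves (leaf x)   = x ∷ []
leaves (node l r) = leaves l ++ leaves r

module _ {n : ℕ} where
  open import Data.List.Membership.DecPropositional (_≟ᶠ_ {n}) public
    using () renaming (_∈?_ to _∈ˡ?_)

IsHCTree : {n : ℕ} → Tree n → Set
IsHCTree {n} t = leaves t ↭ allFin n

nodeSet : {n : ℕ} → Tree n → Subset n
nodeSet t = Data.Vec.tabulate (λ x → ⌊ x ∈ˡ? leaves t ⌋)
  where import Data.Vec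

lcaSize : {n : ℕ} → Tree n → Fin n → Fin n → ℕ
lcaSize (leaf x) u v = 1
lcaSize (node l r) u v with u ∈ˡ? leaves l | v ∈ˡ? leaves l | u ∈ˡ? leaves r | v ∈ˡ? leaves r
... | yes _ | yes _ | _     | _     = lcaSize l u v
... | _     | _     | yes _ | yes _ = lcaSize r u v
... | _     | _     | _     | _     = length (leaves (node l r))

module _ {n : ℕ} (G : WGraph n) where

  -- cost_G(T) = Σ_{edges {u,v}} w_uv · |leaves(T[u ∨ v])|
  -- (each unordered pair counted once via toℕ u < toℕ v)
  cost : Tree n → ℚ
  cost t = ΣV (λ u → ΣV (λ v →
             if ⌊ toℕ u ℕ.<? toℕ v ⌋
             then w G u v * (Data.Rational._/_ (Data.Integer.+ lcaSize t u v) 1)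
             else 0ℚ))
    where import Data.Integer

  IsOptimal : Tree n → Set
  IsOptimal t = IsHCTree t × (∀ t' → IsHCTree t' → cost t ≤ cost t')

  -- the dense branch: from the root, keep moving to the child of higher
  -- volume; it consists exactly of the nodes of volume > vol(G)/2.
  denseBranch : Tree n → List (Tree n)
  denseBranch t with ½ * volG G <? vol G (nodeSet t)
  ... | no _ = []
  denseBranch (leaf x)   | yes _ = leaf x ∷ []
  denseBranch (node l r) | yes _ with vol G (nodeSet r) ≤? vol G (nodeSet l)
  ... | yes _ = node l r ∷ denseBranch l
  ... | no _  = node l r ∷ denseBranch r

  byDegree : List (Fin n)
  byDegree = map Data.Product.proj₂
    (reverse (sortPairs (map (λ u → (deg G u , u)) (allFin n))))
    where
      import Data.Product
      insert : ℚ × Fin n → List (ℚ × Fin n) → List (ℚ × Fin n)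
      insert p [] = p ∷ []
      insert (a , x) ((b , y) ∷ ys) with a ≤? b
      ... | yes _ = (a , x) ∷ (b , y) ∷ ys
      ... | no _  = (b , y) ∷ insert (a , x) ys
      sortPairs : List (ℚ × Fin n) → List (ℚ × Fin n)
      sortPairs = foldr insert []

  -- recursive construction on a nonempty list V' = x ∷ xs (fuel ≥ |xs|);
  -- with r = 2^⌊log₂(|V'| - 1)⌋ the first r vertices form the left child
  buildDeg : ℕ → Fin n → List (Fin n) → Tree n
  buildDeg zero x xs = leaf x
  buildDeg (suc k) x [] = leaf x
  buildDeg (suc k) x (y ∷ ys)
    with splitAt (2 ℕ.^ ⌊log₂ (length (y ∷ ys)) ⌋) (x ∷ y ∷ ys)
  ... | (a ∷ as , b ∷ bs) = node (buildDeg k a as) (buildDeg k b bs)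
  ... | _ = leaf x   -- unreachable: 1 ≤ r < |V'|

Tdeg : {m : ℕ} → WGraph (suc m) → Tree (suc m)
Tdeg G with byDegree G
... | [] = leaf Data.Fin.zero   -- unreachable: V is nonempty
  where import Data.Fin
... | x ∷ xs = buildDeg G (length (x ∷ xs)) x xs

{-# OPTIONS --safe #-}
-- Write T* = node l r and A for the leaf set of l. Since the dense branch of T* is just its
-- root, A and its complement (the leaves of r) both have volume at most vol(G)/2, so the
-- conductance gives φ·vol(A) ≤ w(A, V∖A) and φ·vol(V∖A) ≤ w(A, V∖A). Adding, and using
-- vol(G) = 2·w(E), yields φ·w(E) ≤ w(A, V∖A). Every edge crossing A is split at the root of
-- T*, so cost(T*) ≥ n·w(A, V∖A), whereas any tree with at most n leaves costs at most n·w(E).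
-- Hence φ·cost(T) ≤ cost(T*).
module Submission where

open import Defs
open import Data.Nat using (ℕ; suc)
open import Data.List using (_∷_; [])
open import Data.Product using (_×_)
open import Data.Rational using (ℚ; 0ℚ; _>_; _≤_; _÷_; >-nonZero)
open import Relation.Binary.PropositionalEquality using (_≡_)

open import Algebra.Bundles using (CommutativeRing)
open import Data.Bool using (Bool; true; false; if_then_else_; not; _∧_; _xor_)
open import Data.Bool.Properties using (T-≡; xor-comm; xor-same)
open import Data.Empty using (⊥-elim)
open import Data.Fin using (Fin; zero; suc; toℕ)
open import Data.Fin.Properties using (toℕ-injective)
open import Data.Fin.Subset using (Subset; _∈_; ∁)
open import Data.Fin.Subset.Properties using (_∈?_; x∈p⇒x∉∁p; x∈∁p⇒x∉p)
import Data.Integer as ℤ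
import Data.Integer.Properties as ℤP
open import Data.List using (List; length; map; foldr; reverse; allFin; splitAt; take; drop; _++_; tabulate)
open import Data.List.Membership.Propositional using () renaming (_∈_ to _∈ˡ_; _∉_ to _∉ˡ_)
open import Data.List.Membership.Propositional.Properties using (∈-allFin; ∈-++⁻; ∈-++⁺ˡ)
open import Data.List.Properties
  using (map-cong; length-++; length-++-≤ˡ; length-++-≤ʳ; length-map; length-reverse; length-tabulate; ∷-injectiveʳ; splitAt-defn; take++drop≡id)
open import Data.List.Relation.Unary.All as All using ()
open import Data.List.Relation.Unary.All.Properties using (++⁻ʳ)
open import Data.List.Relation.Unary.AllPairs using (_∷_)
open import Data.List.Relation.Unary.Any using (here; there)
open import Data.List.Relation.Unary.Unique.Propositional using (Unique)
open import Data.List.Relation.Unary.Unique.Propositional.Properties using (allFin⁺)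
open import Data.List.Relation.Binary.Permutation.Propositional using (↭-sym; ↭⇒↭ₛ)
open import Data.List.Relation.Binary.Permutation.Propositional.Properties using (∈-resp-↭; ↭-length)
import Data.List.Relation.Binary.Permutation.Setoid.Properties as Permutationₛ
import Data.Nat as ℕ
import Data.Nat.Properties as ℕP
open import Data.Nat.Logarithm using (⌊log₂_⌋)
open import Data.Nat.Coprimality using (1-coprimeTo) renaming (sym to coprime-sym)
open import Data.Product using (_,_; Σ-syntax; ∃; proj₁; proj₂)
open import Data.Sum using (inj₁; inj₂)
open import Data.Rational using (_+_; _*_; _/_; _<_; 1/_; 1ℚ; ½; NonZero; *≤*; nonNegative; positive; ≢-nonZero)
open import Data.Rational.Properties
  using ( _≟_; _≤?_; _<?_; ≤-refl; ≤-reflexive; ≤-trans; <⇒≤; ≰⇒>; ≮⇒≥; <-irrefl; <-≤-trans; module ≤-Reasoning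
        ; +-identityˡ; +-identityʳ; *-identityʳ; *-zeroʳ; *-comm; *-assoc; *-distribˡ-+; *-inverseˡ
        ; +-mono-≤; +-mono-<; *-monoˡ-≤-nonNeg; *-cancelʳ-≤-pos; normalize-coprime; +-*-commutativeRing )
open import Data.Vec using (lookup; _∷_)
open import Data.Vec.Properties using (lookup∘tabulate; lookup-map; lookup⇒[]=; tabulate-cong; tabulate-∘)
open import Data.Vec.Functional using (Vector)
open import Function using (_∘_; id; flip; Equivalence)
open import Relation.Binary.PropositionalEquality using (refl; sym; trans; cong; cong₂; subst; setoid; module ≡-Reasoning)
open import Relation.Nullary using (yes; no; contradiction)
open import Relation.Nullary.Decidable using (⌊_⌋; ⌊⌋-map′; fromWitness)

open import Algebra.Properties.Semiring.Sum (CommutativeRing.semiring +-*-commutativeRing)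
  using (sum; ∑-distrib-+; ∑-comm; *-distribˡ-sum; sum-replicate-zero)
open import Algebra.Properties.CommutativeSemigroup (CommutativeRing.*-commutativeSemigroup +-*-commutativeRing)
  using (x∙yz≈y∙xz)

fromℕ : ℕ → ℚ
fromℕ k = ℤ.+ k / 1

fromℕ-mono-≤ : ∀ {j k} → j ℕ.≤ k → fromℕ j ≤ fromℕ k
fromℕ-mono-≤ {j} {k} j≤k
  rewrite normalize-coprime (coprime-sym (1-coprimeTo j))
        | normalize-coprime (coprime-sym (1-coprimeTo k))
  = *≤* (ℤP.*-monoʳ-≤-nonNeg (ℤ.+ 1) (ℤ.+≤+ j≤k))

fromℕ-nonNeg : ∀ k → 0ℚ ≤ fromℕ k
fromℕ-nonNeg k = fromℕ-mono-≤ {0} {k} ℕ.z≤n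

p÷q*q≡p : ∀ p q .{{_ : NonZero q}} → (p ÷ q) * q ≡ p
p÷q*q≡p p q = begin
  p * 1/ q * q   ≡⟨ *-assoc p (1/ q) q ⟩
  p * (1/ q * q) ≡⟨ cong (p *_) (*-inverseˡ q) ⟩
  p * 1ℚ         ≡⟨ *-identityʳ p ⟩
  p              ∎
  where open ≡-Reasoning

*≤⇒≤÷ : ∀ {p q r} (r>0 : r > 0ℚ) → r * p ≤ q → p ≤ _÷_ q r {{>-nonZero r>0}}
*≤⇒≤÷ {p} {q} {r} r>0 rp≤q = *-cancelʳ-≤-pos r (begin
  p * r                ≡⟨ *-comm p r ⟩
  r * p                ≤⟨ rp≤q ⟩
  q                    ≡⟨ p÷q*q≡p q r ⟨
  _÷_ q r * r          ∎)
  where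
  open ≤-Reasoning
  instance
    _ = >-nonZero r>0
    _ = positive r>0

a+a≤b+b⇒a≤b : ∀ {a b} → a + a ≤ b + b → a ≤ b
a+a≤b+b⇒a≤b {a} {b} h with a ≤? b
... | yes a≤b = a≤b
... | no a≰b  = ⊥-elim (<-irrefl refl (<-≤-trans (+-mono-< b<a b<a) h))
  where b<a = ≰⇒> a≰b

onlyIf : Bool → ℚ → ℚ
onlyIf b x = if b then x else 0ℚ

onlyIf-mono-≤ : ∀ b {x y} → x ≤ y → onlyIf b x ≤ onlyIf b y
onlyIf-mono-≤ true  x≤y = x≤y
onlyIf-mono-≤ false _   = ≤-refl

onlyIf-nonNeg : ∀ b {x} → 0ℚ ≤ x → 0ℚ ≤ onlyIf b x
onlyIf-nonNeg true  0≤x = 0≤x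
onlyIf-nonNeg false _   = ≤-refl

*-distribˡ-onlyIf : ∀ c b x → c * onlyIf b x ≡ onlyIf b (c * x)
*-distribˡ-onlyIf c true  x = refl
*-distribˡ-onlyIf c false x = *-zeroʳ c

onlyIf+onlyIf-not : ∀ b x → onlyIf b x + onlyIf (not b) x ≡ x
onlyIf+onlyIf-not true  x = +-identityʳ x
onlyIf+onlyIf-not false x = +-identityˡ x

onlyIf-∧-not+onlyIf-∧-not : ∀ a b x →
  onlyIf (a ∧ not b) x + onlyIf (not a ∧ not (not b)) x ≡ onlyIf (a xor b) x
onlyIf-∧-not+onlyIf-∧-not true  true  x = +-identityʳ 0ℚ
onlyIf-∧-not+onlyIf-∧-not true  false x = +-identityʳ x
onlyIf-∧-not+onlyIf-∧-not false true  x = +-identityˡ x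
onlyIf-∧-not+onlyIf-∧-not false false x = +-identityʳ 0ℚ

sum-mono-≤ : ∀ {n} {f g : Vector ℚ n} → (∀ i → f i ≤ g i) → sum f ≤ sum g
sum-mono-≤ {ℕ.zero} f≤g = ≤-refl
sum-mono-≤ {suc n}  f≤g = +-mono-≤ (f≤g zero) (sum-mono-≤ (f≤g ∘ suc))

Σℚ-map-tabulate : ∀ {A : Set} {n} (f : A → ℚ) (g : Fin n → A) → Σℚ (map f (tabulate g)) ≡ sum (f ∘ g)
Σℚ-map-tabulate {n = ℕ.zero} f g = refl
Σℚ-map-tabulate {n = suc n}  f g = cong (f (g zero) +_) (Σℚ-map-tabulate f (g ∘ suc))

ΣV≡sum : ∀ {n} (f : Fin n → ℚ) → ΣV f ≡ sum f
ΣV≡sum f = Σℚ-map-tabulate f id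

module _ {n : ℕ} where

  ΣV-cong : {f g : Fin n → ℚ} → (∀ u → f u ≡ g u) → ΣV f ≡ ΣV g
  ΣV-cong f≗g = cong Σℚ (map-cong f≗g (allFin n))

  ΣV-distrib-+ : (f g : Fin n → ℚ) → ΣV (λ u → f u + g u) ≡ ΣV f + ΣV g
  ΣV-distrib-+ f g rewrite ΣV≡sum f | ΣV≡sum g | ΣV≡sum (λ u → f u + g u) = ∑-distrib-+ f g

  *-distribˡ-ΣV : ∀ c (f : Fin n → ℚ) → c * ΣV f ≡ ΣV (λ u → c * f u)
  *-distribˡ-ΣV c f rewrite ΣV≡sum f | ΣV≡sum (λ u → c * f u) = *-distribˡ-sum c f

  ΣV-mono-≤ : {f g : Fin n → ℚ} → (∀ u → f u ≤ g u) → ΣV f ≤ ΣV g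
  ΣV-mono-≤ {f} {g} f≤g rewrite ΣV≡sum f | ΣV≡sum g = sum-mono-≤ f≤g

  ΣV-nonNeg : {f : Fin n → ℚ} → (∀ u → 0ℚ ≤ f u) → 0ℚ ≤ ΣV f
  ΣV-nonNeg {f} 0≤f = subst (_≤ ΣV f) (trans (ΣV≡sum {n} (λ _ → 0ℚ)) (sum-replicate-zero n)) (ΣV-mono-≤ 0≤f)

  ΣV²≡sum² : (F : Fin n → Fin n → ℚ) → ΣV (λ u → ΣV (F u)) ≡ sum (λ u → sum (F u))
  ΣV²≡sum² F = trans (ΣV-cong (λ u → ΣV≡sum (F u))) (ΣV≡sum {n} (λ u → sum (F u)))

  ΣV-comm : (F : Fin n → Fin n → ℚ) → ΣV (λ u → ΣV (F u)) ≡ ΣV (λ v → ΣV (λ u → F u v))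
  ΣV-comm F = trans (ΣV²≡sum² F) (trans (∑-comm F) (sym (ΣV²≡sum² (flip F))))

  ΣV²-distrib-+ : (F H : Fin n → Fin n → ℚ) →
                  ΣV (λ u → ΣV (λ v → F u v + H u v)) ≡ ΣV (λ u → ΣV (F u)) + ΣV (λ u → ΣV (H u))
  ΣV²-distrib-+ F H = trans (ΣV-cong (λ u → ΣV-distrib-+ (F u) (H u))) (ΣV-distrib-+ _ _)

  ordered : Fin n → Fin n → Bool
  ordered u v = ⌊ toℕ u ℕ.<? toℕ v ⌋

  Σ< : (Fin n → Fin n → ℚ) → ℚ
  Σ< F = ΣV λ u → ΣV λ v → onlyIf (ordered u v) (F u v)

  Σ<-mono-≤ : {F H : Fin n → Fin n → ℚ} → (∀ u v → F u v ≤ H u v) → Σ< F ≤ Σ< H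
  Σ<-mono-≤ F≤H = ΣV-mono-≤ λ u → ΣV-mono-≤ λ v → onlyIf-mono-≤ (ordered u v) (F≤H u v)

  *-distribˡ-Σ< : ∀ c (F : Fin n → Fin n → ℚ) → c * Σ< F ≡ Σ< (λ u v → c * F u v)
  *-distribˡ-Σ< c F = trans (*-distribˡ-ΣV c _) (ΣV-cong λ u →
    trans (*-distribˡ-ΣV c _) (ΣV-cong λ v → *-distribˡ-onlyIf c (ordered u v) (F u v)))

  split-by-order : (F : Fin n → Fin n → ℚ) → (∀ u → F u u ≡ 0ℚ) → ∀ u v →
                   F u v ≡ onlyIf (ordered u v) (F u v) + onlyIf (ordered v u) (F u v)
  split-by-order F F-diag u v with toℕ u ℕ.<? toℕ v | toℕ v ℕ.<? toℕ u
  ... | yes u<v | yes v<u = contradiction v<u (ℕP.<-asym u<v)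
  ... | yes _   | no _    = sym (+-identityʳ _)
  ... | no _    | yes _   = sym (+-identityˡ _)
  ... | no u≮v  | no v≮u with refl ← toℕ-injective (ℕP.≤-antisym (ℕP.≮⇒≥ v≮u) (ℕP.≮⇒≥ u≮v))
    = trans (F-diag u) (sym (+-identityʳ 0ℚ))

  ΣV²≡Σ<+Σ< : (F : Fin n → Fin n → ℚ) → (∀ u v → F u v ≡ F v u) → (∀ u → F u u ≡ 0ℚ) →
              ΣV (λ u → ΣV (F u)) ≡ Σ< F + Σ< F
  ΣV²≡Σ<+Σ< F F-sym F-diag = begin
    ΣV (λ u → ΣV (F u))
      ≡⟨ ΣV-cong (λ u → ΣV-cong (split-by-order F F-diag u)) ⟩
    ΣV (λ u → ΣV (λ v → onlyIf (ordered u v) (F u v) + onlyIf (ordered v u) (F u v)))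
      ≡⟨ ΣV²-distrib-+ _ _ ⟩
    Σ< F + ΣV (λ u → ΣV (λ v → onlyIf (ordered v u) (F u v)))
      ≡⟨ cong (Σ< F +_) (ΣV-comm _) ⟩
    Σ< F + ΣV (λ v → ΣV (λ u → onlyIf (ordered v u) (F u v)))
      ≡⟨ cong (Σ< F +_) (ΣV-cong λ v → ΣV-cong λ u → cong (onlyIf (ordered v u)) (F-sym u v)) ⟩
    Σ< F + Σ< F ∎
    where open ≡-Reasoning

⌊∈?⌋≡lookup : ∀ {n} (x : Fin n) (S : Subset n) → ⌊ x ∈? S ⌋ ≡ lookup S x
⌊∈?⌋≡lookup zero    (true ∷ S)  = refl
⌊∈?⌋≡lookup zero    (false ∷ S) = refl
⌊∈?⌋≡lookup (suc x) (s ∷ S)     = trans (⌊⌋-map′ _ _ (x ∈? S)) (⌊∈?⌋≡lookup x S)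

⌊∈?∁⌋≡not : ∀ {n} (x : Fin n) (S : Subset n) → ⌊ x ∈? ∁ S ⌋ ≡ not ⌊ x ∈? S ⌋
⌊∈?∁⌋≡not x S = begin
  ⌊ x ∈? ∁ S ⌋       ≡⟨ ⌊∈?⌋≡lookup x (∁ S) ⟩
  lookup (∁ S) x     ≡⟨ lookup-map x not S ⟩
  not (lookup S x)   ≡⟨ cong not (⌊∈?⌋≡lookup x S) ⟨
  not ⌊ x ∈? S ⌋     ∎
  where open ≡-Reasoning

⌊∈?nodeSet⌋ : ∀ {n} (t : Tree n) x → ⌊ x ∈? nodeSet t ⌋ ≡ ⌊ x ∈ˡ? leaves t ⌋
⌊∈?nodeSet⌋ t x = trans (⌊∈?⌋≡lookup x (nodeSet t)) (lookup∘tabulate _ x)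

-- Here and in lcaSize≤size the cases are split just finely enough for lcaSize to reduce;
-- the cases omitted below make the xor hypothesis false ≡ true.
lcaSize-separated : ∀ {n} (l r : Tree n) → (∀ {x} → x ∈ˡ leaves l → x ∉ˡ leaves r) →
  ∀ u v → ⌊ u ∈ˡ? leaves l ⌋ xor ⌊ v ∈ˡ? leaves l ⌋ ≡ true → lcaSize (node l r) u v ≡ length (leaves (node l r))
lcaSize-separated l r disjoint u v separated
  with u ∈ˡ? leaves l | v ∈ˡ? leaves l | u ∈ˡ? leaves r | v ∈ˡ? leaves r
... | yes u∈l | no _    | yes u∈r | _       = contradiction u∈r (disjoint u∈l)
... | yes _   | no _    | no _    | _       = refl
... | no _    | yes v∈l | _       | yes v∈r = contradiction v∈r (disjoint v∈l)
... | no _    | yes _   | yes _   | no _    = refl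
... | no _    | yes _   | no _    | no _    = refl

lcaSize≤size : ∀ {n} (t : Tree n) u v → lcaSize t u v ℕ.≤ length (leaves t)
lcaSize≤size (leaf x) u v = ℕP.≤-refl
lcaSize≤size (node l r) u v
  with u ∈ˡ? leaves l | v ∈ˡ? leaves l | u ∈ˡ? leaves r | v ∈ˡ? leaves r
... | yes _ | yes _ | _     | _     = ℕP.≤-trans (lcaSize≤size l u v) (length-++-≤ˡ (leaves l))
... | no _  | _     | yes _ | yes _ = ℕP.≤-trans (lcaSize≤size r u v) (length-++-≤ʳ (leaves r) {leaves l})
... | yes _ | no _  | yes _ | yes _ = ℕP.≤-trans (lcaSize≤size r u v) (length-++-≤ʳ (leaves r) {leaves l})
... | yes _ | no _  | yes _ | no _  = ℕP.≤-refl
... | yes _ | no _  | no _  | _     = ℕP.≤-refl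
... | no _  | _     | yes _ | no _  = ℕP.≤-refl
... | no _  | _     | no _  | _     = ℕP.≤-refl

some-leaf : ∀ {n} (t : Tree n) → ∃ (_∈ˡ leaves t)
some-leaf (leaf x)   = x , here refl
some-leaf (node l r) = proj₁ (some-leaf l) , ∈-++⁺ˡ (proj₂ (some-leaf l))

∈-nodeSet⁺ : ∀ {n} {x : Fin n} (t : Tree n) → x ∈ˡ leaves t → x ∈ nodeSet t
∈-nodeSet⁺ {x = x} t x∈t =
  lookup⇒[]= x (nodeSet t) (trans (lookup∘tabulate _ x) (Equivalence.to T-≡ (fromWitness x∈t)))

Unique-++⇒disjoint : ∀ {A : Set} (xs : List A) {ys x} → Unique (xs ++ ys) → x ∈ˡ xs → x ∉ˡ ys
Unique-++⇒disjoint (_ ∷ xs) (x∉ ∷ _)     (here refl) x∈ys = All.lookup (++⁻ʳ xs x∉) x∈ys refl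
Unique-++⇒disjoint (_ ∷ xs) (_ ∷ unique) (there x∈xs)    = Unique-++⇒disjoint xs unique x∈xs

module _ {n : ℕ} (t : Tree n) (hc : IsHCTree t) where

  HC-∈-leaves : ∀ x → x ∈ˡ leaves t
  HC-∈-leaves x = ∈-resp-↭ (↭-sym hc) (∈-allFin x)

  HC-length-leaves : length (leaves t) ≡ n
  HC-length-leaves = trans (↭-length hc) (length-tabulate id)

  HC-unique-leaves : Unique (leaves t)
  HC-unique-leaves = Permutationₛ.Unique-resp-↭ (setoid (Fin n)) (↭⇒↭ₛ (↭-sym hc)) (allFin⁺ n)

module _ {n : ℕ} (l r : Tree n) (hc : IsHCTree (node l r)) where

  HC-children-disjoint : ∀ {x} → x ∈ˡ leaves l → x ∉ˡ leaves r
  HC-children-disjoint = Unique-++⇒disjoint (leaves l) (HC-unique-leaves (node l r) hc)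

  HC-nodeSet-right≡∁left : nodeSet r ≡ ∁ (nodeSet l)
  HC-nodeSet-right≡∁left = trans (tabulate-cong complementary) (tabulate-∘ not _)
    where
    complementary : ∀ x → ⌊ x ∈ˡ? leaves r ⌋ ≡ not ⌊ x ∈ˡ? leaves l ⌋
    complementary x with x ∈ˡ? leaves l | x ∈ˡ? leaves r
    ... | yes x∈l | yes x∈r = contradiction x∈r (HC-children-disjoint x∈l)
    ... | yes _   | no _    = refl
    ... | no _    | yes _   = refl
    ... | no x∉l  | no x∉r  with ∈-++⁻ (leaves l) (HC-∈-leaves (node l r) hc x)
    ...   | inj₁ x∈l = contradiction x∈l x∉l
    ...   | inj₂ x∈r = contradiction x∈r x∉r

HC-leaf-unique : ∀ {n} (x : Fin n) → IsHCTree (leaf x) → ∀ y → y ≡ x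
HC-leaf-unique x hc y with HC-∈-leaves (leaf x) hc y
... | here y≡x = y≡x

module _ {n : ℕ} (G : WGraph n) where

  totalWeight : ℚ
  totalWeight = Σ< (w G)

  crossingWeight : Subset n → ℚ
  crossingWeight S = Σ< λ u v → onlyIf (⌊ u ∈? S ⌋ xor ⌊ v ∈? S ⌋) (w G u v)

  volG≡totalWeight+totalWeight : volG G ≡ totalWeight + totalWeight
  volG≡totalWeight+totalWeight = ΣV²≡Σ<+Σ< (w G) (w-sym G) (w-noloop G)

  vol+vol∁≡volG : ∀ S → vol G S + vol G (∁ S) ≡ volG G
  vol+vol∁≡volG S = trans (sym (ΣV-distrib-+ (degreeIn S) (degreeIn (∁ S)))) (ΣV-cong pointwise)
    where
    degreeIn : Subset n → Fin n → ℚ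
    degreeIn T u = onlyIf ⌊ u ∈? T ⌋ (deg G u)
    pointwise : ∀ u → degreeIn S u + degreeIn (∁ S) u ≡ deg G u
    pointwise u rewrite ⌊∈?∁⌋≡not u S = onlyIf+onlyIf-not ⌊ u ∈? S ⌋ (deg G u)

  cut+cut∁≡crossingWeight+crossingWeight : ∀ S → cut G S + cut G (∁ S) ≡ crossingWeight S + crossingWeight S
  cut+cut∁≡crossingWeight+crossingWeight S = begin
    cut G S + cut G (∁ S)                                    ≡⟨ ΣV²-distrib-+ (leaving S) (leaving (∁ S)) ⟨
    ΣV (λ u → ΣV (λ v → leaving S u v + leaving (∁ S) u v))  ≡⟨ ΣV-cong (λ u → ΣV-cong (pointwise u)) ⟩
    ΣV (λ u → ΣV (crossing u))                               ≡⟨ ΣV²≡Σ<+Σ< crossing crossing-sym crossing-diag ⟩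
    crossingWeight S + crossingWeight S                      ∎
    where
    open ≡-Reasoning
    leaving : Subset n → Fin n → Fin n → ℚ
    leaving T u v = onlyIf (⌊ u ∈? T ⌋ ∧ not ⌊ v ∈? T ⌋) (w G u v)
    crossing : Fin n → Fin n → ℚ
    crossing u v = onlyIf (⌊ u ∈? S ⌋ xor ⌊ v ∈? S ⌋) (w G u v)
    pointwise : ∀ u v → leaving S u v + leaving (∁ S) u v ≡ crossing u v
    pointwise u v rewrite ⌊∈?∁⌋≡not u S | ⌊∈?∁⌋≡not v S =
      onlyIf-∧-not+onlyIf-∧-not ⌊ u ∈? S ⌋ ⌊ v ∈? S ⌋ (w G u v)
    crossing-sym : ∀ u v → crossing u v ≡ crossing v u
    crossing-sym u v = cong₂ onlyIf (xor-comm ⌊ u ∈? S ⌋ ⌊ v ∈? S ⌋) (w-sym G u v)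
    crossing-diag : ∀ u → crossing u u ≡ 0ℚ
    crossing-diag u rewrite xor-same ⌊ u ∈? S ⌋ = refl

  vol-nonNeg : ∀ S → 0ℚ ≤ vol G S
  vol-nonNeg S = ΣV-nonNeg λ u → onlyIf-nonNeg ⌊ u ∈? S ⌋ (ΣV-nonNeg (w-nonneg G u))

  ≤ratio⇒*vol≤cut : ∀ {φ} S → 0ℚ < φ → φ ≤ ratio G S → φ * vol G S ≤ cut G S
  ≤ratio⇒*vol≤cut {φ} S φ>0 φ≤ratio with vol G S ≟ 0ℚ
  ... | yes _ = ⊥-elim (<-irrefl refl (<-≤-trans φ>0 φ≤ratio))  -- ratio is 0ℚ on null volume
  ... | no vol≢0 = begin
    φ * vol G S                   ≡⟨ *-comm φ (vol G S) ⟩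
    vol G S * φ                   ≤⟨ *-monoˡ-≤-nonNeg (vol G S) φ≤ratio ⟩
    vol G S * (cut G S ÷ vol G S) ≡⟨ *-comm (vol G S) _ ⟩
    (cut G S ÷ vol G S) * vol G S ≡⟨ p÷q*q≡p (cut G S) (vol G S) ⟩
    cut G S                       ∎
    where
    open ≤-Reasoning
    instance
      _ = ≢-nonZero vol≢0
      _ = nonNegative (vol-nonNeg S)

  *totalWeight≤crossingWeight : ∀ {φ} S → 0ℚ < φ → φ ≤ ratio G S → φ ≤ ratio G (∁ S) →
                                φ * totalWeight ≤ crossingWeight S
  *totalWeight≤crossingWeight {φ} S φ>0 φ≤ratio φ≤ratio∁ = a+a≤b+b⇒a≤b (begin
    φ * totalWeight + φ * totalWeight ≡⟨ *-distribˡ-+ φ totalWeight totalWeight ⟨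
    φ * (totalWeight + totalWeight)   ≡⟨ cong (φ *_) volG≡totalWeight+totalWeight ⟨
    φ * volG G                        ≡⟨ cong (φ *_) (vol+vol∁≡volG S) ⟨
    φ * (vol G S + vol G (∁ S))       ≡⟨ *-distribˡ-+ φ (vol G S) (vol G (∁ S)) ⟩
    φ * vol G S + φ * vol G (∁ S)     ≤⟨ +-mono-≤ (≤ratio⇒*vol≤cut S φ>0 φ≤ratio) (≤ratio⇒*vol≤cut (∁ S) φ>0 φ≤ratio∁) ⟩
    cut G S + cut G (∁ S)             ≡⟨ cut+cut∁≡crossingWeight+crossingWeight S ⟩
    crossingWeight S + crossingWeight S ∎)
    where open ≤-Reasoning

  cost≤size*totalWeight : ∀ k T → (∀ u v → lcaSize T u v ℕ.≤ k) → cost G T ≤ fromℕ k * totalWeight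
  cost≤size*totalWeight k T lca≤k = begin
    cost G T                              ≤⟨ Σ<-mono-≤ pairwise ⟩
    Σ< (λ u v → fromℕ k * w G u v)         ≡⟨ *-distribˡ-Σ< (fromℕ k) (w G) ⟨
    fromℕ k * totalWeight                  ∎
    where
    open ≤-Reasoning
    pairwise : ∀ u v → w G u v * fromℕ (lcaSize T u v) ≤ fromℕ k * w G u v
    pairwise u v = ≤-trans (*-monoˡ-≤-nonNeg (w G u v) {{nonNegative (w-nonneg G u v)}} (fromℕ-mono-≤ (lca≤k u v)))
                           (≤-reflexive (*-comm (w G u v) (fromℕ k)))

  size*crossingWeight≤cost : ∀ l r → (∀ {x} → x ∈ˡ leaves l → x ∉ˡ leaves r) →
    fromℕ (length (leaves (node l r))) * crossingWeight (nodeSet l) ≤ cost G (node l r)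
  size*crossingWeight≤cost l r disjoint = begin
    N * crossingWeight (nodeSet l)
      ≡⟨ *-distribˡ-Σ< N (λ u v → onlyIf (separated u v) (w G u v)) ⟩
    Σ< (λ u v → N * onlyIf (separated u v) (w G u v))
      ≤⟨ Σ<-mono-≤ pairwise ⟩
    cost G (node l r) ∎
    where
    open ≤-Reasoning
    N = fromℕ (length (leaves (node l r)))
    separated : Fin n → Fin n → Bool
    separated u v = ⌊ u ∈? nodeSet l ⌋ xor ⌊ v ∈? nodeSet l ⌋
    pairwise : ∀ u v → N * onlyIf (separated u v) (w G u v) ≤ w G u v * fromℕ (lcaSize (node l r) u v)
    pairwise u v with separated u v in sep
    ... | true = ≤-reflexive (begin-equality
      N * w G u v                                 ≡⟨ *-comm N (w G u v) ⟩
      w G u v * N                                 ≡⟨ cong (λ k → w G u v * fromℕ k) (lcaSize-separated l r disjoint u v sep′) ⟨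
      w G u v * fromℕ (lcaSize (node l r) u v)    ∎)
      where sep′ = trans (sym (cong₂ _xor_ (⌊∈?nodeSet⌋ l u) (⌊∈?nodeSet⌋ l v))) sep
    ... | false = begin
      N * 0ℚ                                      ≡⟨ trans (*-zeroʳ N) (sym (*-zeroʳ (w G u v))) ⟩
      w G u v * 0ℚ
        ≤⟨ *-monoˡ-≤-nonNeg (w G u v) {{nonNegative (w-nonneg G u v)}} (fromℕ-nonNeg (lcaSize (node l r) u v)) ⟩
      w G u v * fromℕ (lcaSize (node l r) u v)    ∎

module _ {n : ℕ} (G : WGraph n) where

  denseBranch≡[]⇒light : ∀ t → denseBranch G t ≡ [] → vol G (nodeSet t) ≤ ½ * volG G
  denseBranch≡[]⇒light t branch≡[] with ½ * volG G <? vol G (nodeSet t)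
  ... | no not-dense = ≮⇒≥ not-dense
  denseBranch≡[]⇒light (leaf x) () | yes _
  denseBranch≡[]⇒light (node l r) branch≡[] | yes _ with vol G (nodeSet r) ≤? vol G (nodeSet l)
  denseBranch≡[]⇒light (node l r) () | yes _ | yes _
  denseBranch≡[]⇒light (node l r) () | yes _ | no _

  denseBranch≡root⇒children-light : ∀ l r → denseBranch G (node l r) ≡ node l r ∷ [] →
    vol G (nodeSet l) ≤ ½ * volG G × vol G (nodeSet r) ≤ ½ * volG G
  denseBranch≡root⇒children-light l r branch≡root with ½ * volG G <? vol G (nodeSet (node l r))
  ... | yes _ with vol G (nodeSet r) ≤? vol G (nodeSet l)
  ...   | yes r≤l = l-light , ≤-trans r≤l l-light
    where l-light = denseBranch≡[]⇒light l (∷-injectiveʳ branch≡root)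
  ...   | no r≰l = ≤-trans (<⇒≤ (≰⇒> r≰l)) r-light , r-light
    where r-light = denseBranch≡[]⇒light r (∷-injectiveʳ branch≡root)

  children-admissible : ∀ l r → IsHCTree (node l r) → denseBranch G (node l r) ≡ node l r ∷ [] →
    Admissible G (nodeSet l) × Admissible G (∁ (nodeSet l))
  children-admissible l r hc branch≡root =
    ((x , x∈A) , (y , x∈∁p⇒x∉p y∈∁A) , proj₁ light) ,
    ((y , y∈∁A) , (x , x∈p⇒x∉∁p x∈A) , subst (λ S → vol G S ≤ ½ * volG G) (HC-nodeSet-right≡∁left l r hc) (proj₂ light))
    where
    light = denseBranch≡root⇒children-light l r branch≡root
    x = proj₁ (some-leaf l)
    y = proj₁ (some-leaf r)
    x∈A : x ∈ nodeSet l
    x∈A = ∈-nodeSet⁺ l (proj₂ (some-leaf l))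
    y∈∁A : y ∈ ∁ (nodeSet l)
    y∈∁A = subst (y ∈_) (HC-nodeSet-right≡∁left l r hc) (∈-nodeSet⁺ r (proj₂ (some-leaf r)))

length-splitAt : ∀ {A : Set} k (zs : List A) {p q} → splitAt k zs ≡ (p , q) → length p ℕ.+ length q ≡ length zs
length-splitAt k zs {p} {q} split≡ = begin
  length p ℕ.+ length q             ≡⟨ length-++ p ⟨
  length (p ++ q)                   ≡⟨ cong (λ pq → length (proj₁ pq ++ proj₂ pq)) (trans (sym split≡) (splitAt-defn k zs)) ⟩
  length (take k zs ++ drop k zs)   ≡⟨ cong length (take++drop≡id k zs) ⟩
  length zs                         ∎
  where open ≡-Reasoning

module _ {n : ℕ} (G : WGraph n) where

  private
    Key = ℚ × Fin n

    keys : List Key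
    keys = map (λ u → (deg G u , u)) (allFin n)

    -- The insertion step of byDegree is local to its where-block; unification recovers it.
    byDegree-insertionSort : Σ[ insert ∈ (Key → List Key → List Key) ]
                             byDegree G ≡ map proj₂ (reverse (foldr insert [] keys))
    byDegree-insertionSort = _ , refl

    insert = proj₁ byDegree-insertionSort

    length-insert : ∀ p ps → length (insert p ps) ≡ suc (length ps)
    length-insert p [] = refl
    length-insert (a , x) ((b , y) ∷ ps) with a ≤? b
    ... | yes _ = refl
    ... | no _  = cong suc (length-insert (a , x) ps)

    length-insertionSort : ∀ ps → length (foldr insert [] ps) ≡ length ps
    length-insertionSort []       = refl
    length-insertionSort (p ∷ ps) = trans (length-insert p (foldr insert [] ps)) (cong suc (length-insertionSort ps))

  length-byDegree : length (byDegree G) ≡ n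
  length-byDegree = begin
    length (byDegree G)                                  ≡⟨ cong length (proj₂ byDegree-insertionSort) ⟩
    length (map proj₂ (reverse (foldr insert [] keys)))  ≡⟨ length-map proj₂ (reverse (foldr insert [] keys)) ⟩
    length (reverse (foldr insert [] keys))              ≡⟨ length-reverse (foldr insert [] keys) ⟩
    length (foldr insert [] keys)                        ≡⟨ length-insertionSort keys ⟩
    length keys                                          ≡⟨ length-map _ (allFin n) ⟩
    length (allFin n)                                    ≡⟨ length-tabulate id ⟩
    n                                                    ∎
    where open ≡-Reasoning

  length-leaves-buildDeg : ∀ k x xs → length (leaves (buildDeg G k x xs)) ℕ.≤ suc (length xs)
  length-leaves-buildDeg ℕ.zero x xs = ℕ.s≤s ℕ.z≤n
  length-leaves-buildDeg (suc k) x [] = ℕP.≤-refl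
  length-leaves-buildDeg (suc k) x (y ∷ ys)
    with splitAt (2 ℕ.^ ⌊log₂ length (y ∷ ys) ⌋) (x ∷ y ∷ ys) in split≡
  ... | (a ∷ as , b ∷ bs) = begin
    length (leaves (buildDeg G k a as) ++ leaves (buildDeg G k b bs))
      ≡⟨ length-++ (leaves (buildDeg G k a as)) ⟩
    length (leaves (buildDeg G k a as)) ℕ.+ length (leaves (buildDeg G k b bs))
      ≤⟨ ℕP.+-mono-≤ (length-leaves-buildDeg k a as) (length-leaves-buildDeg k b bs) ⟩
    suc (length as) ℕ.+ suc (length bs)
      ≡⟨ length-splitAt _ (x ∷ y ∷ ys) split≡ ⟩
    suc (length (y ∷ ys)) ∎
    where open ℕP.≤-Reasoning
  ... | ([] , _)      = ℕ.s≤s ℕ.z≤n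
  ... | (_ ∷ _ , [])  = ℕ.s≤s ℕ.z≤n

length-leaves-Tdeg : ∀ {m} (G : WGraph (suc m)) → length (leaves (Tdeg G)) ℕ.≤ suc m
length-leaves-Tdeg {m} G with byDegree G | length-byDegree G
... | []     | _         = ℕ.s≤s ℕ.z≤n
... | x ∷ xs | length≡n = ℕP.≤-trans (length-leaves-buildDeg G (length (x ∷ xs)) x xs) (ℕP.≤-reflexive length≡n)

cost≤cost÷φ : ∀ {n} (G : WGraph n) {φ} (φ>0 : φ > 0ℚ) l r → IsHCTree (node l r) →
  φ ≤ ratio G (nodeSet l) → φ ≤ ratio G (∁ (nodeSet l)) →
  ∀ T → (∀ u v → lcaSize T u v ℕ.≤ n) → cost G T ≤ _÷_ (cost G (node l r)) φ {{>-nonZero φ>0}}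
cost≤cost÷φ {n} G {φ} φ>0 l r hc φ≤ratio φ≤ratio∁ T lca≤n = *≤⇒≤÷ φ>0 (begin
  φ * cost G T
    ≤⟨ *-monoˡ-≤-nonNeg φ (cost≤size*totalWeight G n T lca≤n) ⟩
  φ * (N * totalWeight G)
    ≡⟨ x∙yz≈y∙xz φ N (totalWeight G) ⟩
  N * (φ * totalWeight G)
    ≤⟨ *-monoˡ-≤-nonNeg N (*totalWeight≤crossingWeight G (nodeSet l) φ>0 φ≤ratio φ≤ratio∁) ⟩
  N * crossingWeight G (nodeSet l)
    ≡⟨ cong (λ k → fromℕ k * crossingWeight G (nodeSet l)) (HC-length-leaves (node l r) hc) ⟨
  fromℕ (length (leaves (node l r))) * crossingWeight G (nodeSet l)
    ≤⟨ size*crossingWeight≤cost G l r (HC-children-disjoint l r hc) ⟩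
  cost G (node l r) ∎)
  where
  open ≤-Reasoning
  N = fromℕ n
  instance
    _ = nonNegative (<⇒≤ φ>0)
    _ = nonNegative (fromℕ-nonNeg n)

lemma3p7 : {m : ℕ} (G : WGraph (suc m)) (φ : ℚ) → IsConductance G φ → (φ>0 : φ > 0ℚ)
    → (T* : Tree (suc m)) → IsOptimal G T* → denseBranch G T* ≡ T* ∷ []
    → ((T : Tree (suc m)) → IsHCTree T → cost G T ≤ _÷_ (cost G T*) φ {{>-nonZero φ>0}})
    × (cost G (Tdeg G) ≤ _÷_ (cost G T*) φ {{>-nonZero φ>0}})
lemma3p7 G φ ((S , ((a , a∈S) , (b , b∉S) , _) , _) , _) _ (leaf x) (hc , _) _ =
  ⊥-elim (b∉S (subst (_∈ S) (trans (HC-leaf-unique x hc a) (sym (HC-leaf-unique x hc b))) a∈S))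
lemma3p7 G φ (_ , φ≤ratio) φ>0 (node l r) (hc , _) branch≡root =
  (λ T hcT → bound T (λ u v → ℕP.≤-trans (lcaSize≤size T u v) (ℕP.≤-reflexive (HC-length-leaves T hcT)))) ,
  bound (Tdeg G) (λ u v → ℕP.≤-trans (lcaSize≤size (Tdeg G) u v) (length-leaves-Tdeg G))
  where
  admissible = children-admissible G l r hc branch≡root
  bound = cost≤cost÷φ G φ>0 l r hc (φ≤ratio _ (proj₁ admissible)) (φ≤ratio _ (proj₂ admissible))
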